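{- For all nonnegative integers $m,n$, let \[ S(m,n)=\frac{(2m)!\,(2n)!}{m!\,n!\,(m+n)!}. \] Let $\mathcal{P}_{m+n}$ be the set of all lattice paths $P=(P_0,P_1,\dots,P_{2(m+n)})$ from $(0,0)$ to $(m+n,m+n)$ consisting of unit steps to the right $(1,0)$ and up $(0,1)$, and for such $P$ let $h_{2m}(P)$ denote the $y$-coordinate of $P_{2m}$ (the height of $P$ after its $2m$-th step). Then \[ S(m,n)=(-1)^m\sum_{P\in\mathcal{P}_{m+n}}(-1)^{h_{2m}(P)}, \] and equivalently \[ K_{m+n}^{2(m+n)}(2m)=(-1)^m S(m,n), \] where for nonnegative integers $j,d$ and integer $x$ the Krawtchouk polynomial is $K_j^d(x)=\sum_{h=0}^{j}(-1)^h\binom{x}{h}\binom{d-x}{j-h}$.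
   Context: $S(m,n)$ are the super Catalan numbers. Binomial coefficients $\binom{a}{b}$ are the usual ones, equal to $0$ when $b<0$ or $b>a\ge 0$. -}

module Defs where

open import Data.Nat.Base using (ℕ; zero; suc; _+_; _*_; _∸_; _/_; _!)
open import Data.Nat.Properties using (m*n≢0; _!≢0)
open import Data.Nat.Combinatorics using (_C_)
open import Data.Integer.Base as ℤ using (ℤ; +_; -1ℤ; _^_)
open import Data.List.Base using (List; []; _∷_; map; concatMap; filter; take; foldr; upTo)
open import Data.Nat.Properties using (_≟_)

-- Super Catalan numbers S(m,n) = (2m)! (2n)! / (m! n! (m+n)!)
-- (the division is exact; ℕ floor division is used)
S : ℕ → ℕ → ℕ
S m n = ((2 * m) ! * (2 * n) !) / (m ! * n ! * (m + n) !)
  where instance _ = m*n≢0 (m ! * n !) ((m + n) !) {{m*n≢0 (m !) (n !) {{m !≢0}} {{n !≢0}}}} {{(m + n) !≢0}}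

-- unit steps of a lattice path: R = (1,0), U = (0,1)
data Step : Set where
  R U : Step

allSeqs : ℕ → List (List Step)
allSeqs zero    = [] ∷ []
allSeqs (suc k) = concatMap (λ p → (R ∷ p) ∷ (U ∷ p) ∷ []) (allSeqs k)

-- number of up steps (= y-coordinate reached)
ups : List Step → ℕ
ups []       = 0
ups (R ∷ p)  = ups p
ups (U ∷ p)  = suc (ups p)

-- 𝒫_N : all lattice paths from (0,0) to (N,N) with unit steps R,U,
-- i.e. step sequences of length 2N with exactly N up steps
paths : ℕ → List (List Step)
paths N = filter (λ p → ups p ≟ N) (allSeqs (2 * N))

height : ℕ → List Step → ℕ
height i p = ups (take i p)

sumℤ : List ℤ → ℤ
sumℤ = foldr ℤ._+_ (+ 0)

sgn : ℕ → ℤ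
sgn k = -1ℤ ^ k

-- Krawtchouk polynomial K_j^d(x) = Σ_{h=0}^{j} (-1)^h C(x,h) C(d-x,j-h),
-- for natural x ≤ d (d - x computed by truncated subtraction; only x ≤ d is used)
K : ℕ → ℕ → ℕ → ℤ
K j d x = sumℤ (map (λ h → sgn h ℤ.* (+ (x C h) ℤ.* + ((d ∸ x) C (j ∸ h)))) (upTo (suc j)))

module Submission where

-- Write  κ(a,b,k) = Σ_{h ≤ k} (-1)^h C(a,h) C(b,k-h),  the coefficient of x^k in
-- (1-x)^a (1+x)^b; by definition the Krawtchouk value K_j^d(x) is κ(x, d-x, j).
--
-- (1) Splitting a path by its first step shows that the signed path sum
--     Σ_P (-1)^{h_a(P)} over paths with a+b steps and k up steps equals
--     κ(a,b,k): both equal C(b,k) for a = 0 and both satisfy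
--     κ(a+1,b,k) = κ(a,b,k) - κ(a,b,k-1).
-- (2) Pascal's rule in a and in b gives κ(a+2,b,k+1) = κ(a,b+2,k+1) - 4 κ(a,b,k),
--     i.e. (1-x)^2 = (1+x)^2 - 4x.  Hence F(m,n) = (-1)^m κ(2m,2n,m+n) satisfies
--     F(0,n) = C(2n,n) and F(m+1,n) = 4 F(m,n) - F(m,n+1).
-- (3) These two properties determine the super Catalan numbers: by induction on
--     m one gets F(m,n) · m! n! (m+n)! = (2m)! (2n)!, so F(m,n) = S(m,n).

open import Defs
open import Data.Nat.Base using (ℕ; zero; suc; _+_; _*_; _∸_; _!; _/_; _<_; _≤_; s≤s; NonZero; ≢-nonZero⁻¹)
open import Data.Nat.Combinatorics using (_C_; nCk+nC[k+1]≡[n+1]C[k+1]; nCk≡n!/k![n-k]!; k![n∸k]!∣n!)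
import Data.Nat.Properties as ℕP
open import Data.Nat.DivMod using (m*n/n≡m; m/n*n≡m)
import Data.Nat.Tactic.RingSolver as ℕSolver
open import Data.Integer.Base using (ℤ; +_; -[1+_]; -1ℤ; _-_) renaming (_*_ to _*ℤ_; _+_ to _+ℤ_)
import Data.Integer.Properties as ℤP
open import Data.Integer.Tactic.RingSolver using (solve-∀)
open import Data.List.Base using (List; []; _∷_; _++_; [_]; map; filter; take; concatMap; upTo)
open import Data.List.Properties using (map-applyUpTo; map-upTo; upTo-∷ʳ)
open import Data.List.Relation.Unary.All using (All; []; _∷_; universal)
open import Data.List.Relation.Unary.All.Properties using (applyUpTo⁺₁)
open import Data.Bool.Base using (true; false; if_then_else_)
open import Data.Empty using (⊥-elim)
open import Data.Product.Base using (_×_; _,_)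
open import Function.Base using (id)
open import Level using (0ℓ)
open import Relation.Nullary.Decidable using (Dec; does)
open import Relation.Unary using (Pred; Decidable)
open import Relation.Binary.PropositionalEquality using (_≡_; refl; sym; trans; cong; cong₂; module ≡-Reasoning)

open ≡-Reasoning

∑ : {A : Set} → List A → (A → ℤ) → ℤ
∑ xs φ = sumℤ (map φ xs)

𝟙 : {P : Set} → Dec P → ℤ
𝟙 d = if does d then + 1 else + 0

module _ {A : Set} where

  ∑-congᴬ : ∀ {φ ψ : A → ℤ} xs → All (λ x → φ x ≡ ψ x) xs → ∑ xs φ ≡ ∑ xs ψ
  ∑-congᴬ []       []       = refl
  ∑-congᴬ (x ∷ xs) (e ∷ es) = cong₂ _+ℤ_ e (∑-congᴬ xs es)

  ∑-cong : ∀ {φ ψ : A → ℤ} xs → (∀ x → φ x ≡ ψ x) → ∑ xs φ ≡ ∑ xs ψ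
  ∑-cong xs e = ∑-congᴬ xs (universal e xs)

  ∑-zero : ∀ (xs : List A) → ∑ xs (λ _ → + 0) ≡ + 0
  ∑-zero []       = refl
  ∑-zero (x ∷ xs) = trans (ℤP.+-identityˡ _) (∑-zero xs)

  ∑-+ : ∀ (φ ψ : A → ℤ) xs → ∑ xs (λ x → φ x +ℤ ψ x) ≡ ∑ xs φ +ℤ ∑ xs ψ
  ∑-+ φ ψ []       = refl
  ∑-+ φ ψ (x ∷ xs) = trans (cong (φ x +ℤ ψ x +ℤ_) (∑-+ φ ψ xs)) (interchange (φ x) (ψ x) _ _)
    where
    interchange : ∀ a b c d → (a +ℤ b) +ℤ (c +ℤ d) ≡ (a +ℤ c) +ℤ (b +ℤ d)
    interchange = solve-∀

  ∑-- : ∀ (φ ψ : A → ℤ) xs → ∑ xs (λ x → φ x - ψ x) ≡ ∑ xs φ - ∑ xs ψ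
  ∑-- φ ψ []       = refl
  ∑-- φ ψ (x ∷ xs) = trans (cong (φ x - ψ x +ℤ_) (∑-- φ ψ xs)) (interchange (φ x) (ψ x) _ _)
    where
    interchange : ∀ a b c d → (a - b) +ℤ (c - d) ≡ (a +ℤ c) - (b +ℤ d)
    interchange = solve-∀

  ∑-++ : ∀ (φ : A → ℤ) xs ys → ∑ (xs ++ ys) φ ≡ ∑ xs φ +ℤ ∑ ys φ
  ∑-++ φ []       ys = sym (ℤP.+-identityˡ (∑ ys φ))
  ∑-++ φ (x ∷ xs) ys = trans (cong (φ x +ℤ_) (∑-++ φ xs ys)) (sym (ℤP.+-assoc (φ x) _ _))

  ∑-concatMap : ∀ {B : Set} (f : B → List A) (φ : A → ℤ) ys →
                ∑ (concatMap f ys) φ ≡ ∑ ys (λ y → ∑ (f y) φ)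
  ∑-concatMap f φ []       = refl
  ∑-concatMap f φ (y ∷ ys) = trans (∑-++ φ (f y) (concatMap f ys)) (cong (∑ (f y) φ +ℤ_) (∑-concatMap f φ ys))

  ∑-filter : ∀ {P : Pred A 0ℓ} (P? : Decidable P) (φ : A → ℤ) xs →
             ∑ (filter P? xs) φ ≡ ∑ xs (λ x → 𝟙 (P? x) *ℤ φ x)
  ∑-filter P? φ []       = refl
  ∑-filter P? φ (x ∷ xs) with does (P? x)
  ... | true  = cong₂ _+ℤ_ (sym (ℤP.*-identityˡ (φ x))) (∑-filter P? φ xs)
  ... | false = trans (∑-filter P? φ xs) (sym (ℤP.+-identityˡ _))

∑-upTo-cong : ∀ n {f g : ℕ → ℤ} → (∀ {h} → h < n → f h ≡ g h) → ∑ (upTo n) f ≡ ∑ (upTo n) g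
∑-upTo-cong n {f} {g} e = ∑-congᴬ (upTo n) (applyUpTo⁺₁ {P = λ h → f h ≡ g h} id n e)

∑-upTo-head : ∀ (f : ℕ → ℤ) n → ∑ (upTo (suc n)) f ≡ f 0 +ℤ ∑ (upTo n) (λ h → f (suc h))
∑-upTo-head f n = cong (λ xs → f 0 +ℤ sumℤ xs)
  (trans (map-applyUpTo suc f n) (sym (map-upTo (λ h → f (suc h)) n)))

∑-upTo-last : ∀ (f : ℕ → ℤ) n → ∑ (upTo (suc n)) f ≡ ∑ (upTo n) f +ℤ f n
∑-upTo-last f n = begin
  ∑ (upTo (suc n)) f             ≡⟨ cong (λ xs → ∑ xs f) (upTo-∷ʳ n) ⟨
  ∑ (upTo n ++ [ n ]) f          ≡⟨ ∑-++ f (upTo n) [ n ] ⟩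
  ∑ (upTo n) f +ℤ (f n +ℤ + 0)   ≡⟨ cong (∑ (upTo n) f +ℤ_) (ℤP.+-identityʳ (f n)) ⟩
  ∑ (upTo n) f +ℤ f n            ∎

-- prev f k = f(k-1) and prev f 0 = 0: on coefficient sequences this is
-- multiplication of the generating function by x.
prev : (ℕ → ℤ) → ℕ → ℤ
prev f zero    = + 0
prev f (suc k) = f k

prev-cong : ∀ {f g : ℕ → ℤ} → (∀ k → f k ≡ g k) → ∀ k → prev f k ≡ prev g k
prev-cong e zero    = refl
prev-cong e (suc k) = e k

pascal : ∀ b k → + (b C k) +ℤ prev (λ j → + (b C j)) k ≡ + (suc b C k)
pascal b zero    = refl
pascal b (suc k) = cong +_ (trans (ℕP.+-comm (b C suc k) (b C k)) (nCk+nC[k+1]≡[n+1]C[k+1] b k))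

-- κ(a,b,k), the coefficient of x^k in (1-x)^a (1+x)^b.  Note K j d x = κ x (d ∸ x) j
-- holds by definition.
κ-term : ℕ → ℕ → ℕ → ℕ → ℤ
κ-term a b k h = sgn h *ℤ (+ (a C h) *ℤ + (b C (k ∸ h)))

κ : ℕ → ℕ → ℕ → ℤ
κ a b k = ∑ (upTo (suc k)) (κ-term a b k)

-- (1+x)^b has coefficients C(b,k).
κ-zeroˡ : ∀ b k → κ 0 b k ≡ + (b C k)
κ-zeroˡ b k = begin
  κ 0 b k                             ≡⟨ ∑-upTo-head (κ-term 0 b k) k ⟩
  t₀ +ℤ ∑ (upTo k) (λ h → sgn (suc h) *ℤ + 0)
    ≡⟨ cong (t₀ +ℤ_) (trans (∑-cong (upTo k) (λ h → ℤP.*-zeroʳ (sgn (suc h)))) (∑-zero (upTo k))) ⟩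
  t₀ +ℤ + 0                           ≡⟨ ℤP.+-identityʳ t₀ ⟩
  t₀                                  ≡⟨ trans (ℤP.*-identityˡ _) (ℤP.*-identityˡ _) ⟩
  + (b C k)                           ∎
  where t₀ = sgn 0 *ℤ (+ 1 *ℤ + (b C k))

-- Multiplying by (1-x): Pascal's rule in the first argument.
κ-sucˡ : ∀ a b k → κ (suc a) b k ≡ κ a b k - prev (κ a b) k
κ-sucˡ a b zero    = sym (ℤP.+-identityʳ (κ a b 0))
κ-sucˡ a b (suc k) = begin
  κ (suc a) b (suc k)
    ≡⟨ ∑-upTo-head (κ-term (suc a) b (suc k)) (suc k) ⟩
  t₀ +ℤ ∑ (upTo (suc k)) (λ h → sgn (suc h) *ℤ (+ (suc a C suc h) *ℤ c h))
    ≡⟨ cong (t₀ +ℤ_) (∑-cong (upTo (suc k)) split) ⟩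
  t₀ +ℤ ∑ (upTo (suc k)) (λ h → u h - v h)
    ≡⟨ cong (t₀ +ℤ_) (∑-- u v (upTo (suc k))) ⟩
  t₀ +ℤ (∑ (upTo (suc k)) u - κ a b k)
    ≡⟨ ℤP.+-assoc t₀ _ _ ⟨
  t₀ +ℤ ∑ (upTo (suc k)) u - κ a b k
    ≡⟨ cong (_- κ a b k) (∑-upTo-head (κ-term a b (suc k)) (suc k)) ⟨
  κ a b (suc k) - κ a b k ∎
  where
  t₀ = sgn 0 *ℤ (+ 1 *ℤ + (b C suc k))
  c u v : ℕ → ℤ
  c h = + (b C (k ∸ h))
  u h = sgn (suc h) *ℤ (+ (a C suc h) *ℤ c h)
  v = κ-term a b k
  distribute : ∀ s x y z → (-1ℤ *ℤ s) *ℤ ((x +ℤ y) *ℤ z) ≡ (-1ℤ *ℤ s) *ℤ (y *ℤ z) - s *ℤ (x *ℤ z)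
  distribute = solve-∀
  split : ∀ h → sgn (suc h) *ℤ (+ (suc a C suc h) *ℤ c h) ≡ u h - v h
  split h = trans (cong (λ x → sgn (suc h) *ℤ (+ x *ℤ c h)) (sym (nCk+nC[k+1]≡[n+1]C[k+1] a h)))
                  (distribute (sgn h) (+ (a C h)) (+ (a C suc h)) (c h))

-- Multiplying by (1+x): Pascal's rule in the second argument.
κ-sucʳ : ∀ a b k → κ a (suc b) k ≡ κ a b k +ℤ prev (κ a b) k
κ-sucʳ a b zero    = refl
κ-sucʳ a b (suc k) = begin
  κ a (suc b) (suc k)                         ≡⟨ ∑-upTo-last t (suc k) ⟩
  ∑ (upTo (suc k)) t +ℤ t (suc k)              ≡⟨ cong₂ _+ℤ_ (∑-upTo-cong (suc k) split) last ⟩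
  ∑ (upTo (suc k)) (λ h → u h +ℤ v h) +ℤ u (suc k)
                                               ≡⟨ cong (_+ℤ u (suc k)) (∑-+ u v (upTo (suc k))) ⟩
  (∑ (upTo (suc k)) u +ℤ κ a b k) +ℤ u (suc k) ≡⟨ swap (∑ (upTo (suc k)) u) (κ a b k) (u (suc k)) ⟩
  (∑ (upTo (suc k)) u +ℤ u (suc k)) +ℤ κ a b k ≡⟨ cong (_+ℤ κ a b k) (∑-upTo-last u (suc k)) ⟨
  κ a b (suc k) +ℤ κ a b k                     ∎
  where
  t u v : ℕ → ℤ
  t = κ-term a (suc b) (suc k)
  u = κ-term a b (suc k)
  v = κ-term a b k
  swap : ∀ x y z → (x +ℤ y) +ℤ z ≡ (x +ℤ z) +ℤ y
  swap = solve-∀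
  distribute : ∀ s x y z → s *ℤ (x *ℤ (y +ℤ z)) ≡ s *ℤ (x *ℤ z) +ℤ s *ℤ (x *ℤ y)
  distribute = solve-∀
  last : t (suc k) ≡ u (suc k)
  last rewrite ℕP.n∸n≡0 k = refl
  split : ∀ {h} → h < suc k → t h ≡ u h +ℤ v h
  split {h} (s≤s h≤k) rewrite ℕP.+-∸-assoc 1 h≤k = trans
    (cong (λ x → sgn h *ℤ (+ (a C h) *ℤ + x)) (sym (nCk+nC[k+1]≡[n+1]C[k+1] b (k ∸ h))))
    (distribute (sgn h) (+ (a C h)) (+ (b C (k ∸ h))) (+ (b C suc (k ∸ h))))

-- (1-x)^2 = (1+x)^2 - 4x on coefficients.
κ-step : ∀ a b k → κ (2 + a) b (suc k) ≡ κ a (2 + b) (suc k) - + 4 *ℤ κ a b k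
κ-step a b k = begin
  κ (2 + a) b (suc k)
    ≡⟨ κ-sucˡ (suc a) b (suc k) ⟩
  κ (suc a) b (suc k) - κ (suc a) b k
    ≡⟨ cong₂ _-_ (κ-sucˡ a b (suc k)) (κ-sucˡ a b k) ⟩
  (x₁ - x₀) - (x₀ - y)
    ≡⟨ rearrange x₀ x₁ y ⟩
  (x₁ +ℤ x₀) +ℤ (x₀ +ℤ y) - + 4 *ℤ x₀
    ≡⟨ cong₂ (λ p q → p +ℤ q - + 4 *ℤ x₀) (κ-sucʳ a b (suc k)) (κ-sucʳ a b k) ⟨
  κ a (suc b) (suc k) +ℤ κ a (suc b) k - + 4 *ℤ x₀
    ≡⟨ cong (_- + 4 *ℤ x₀) (κ-sucʳ a (suc b) (suc k)) ⟨
  κ a (2 + b) (suc k) - + 4 *ℤ x₀ ∎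
  where
  x₀ = κ a b k
  x₁ = κ a b (suc k)
  y  = prev (κ a b) k
  rearrange : ∀ x₀ x₁ y → (x₁ - x₀) - (x₀ - y) ≡ (x₁ +ℤ x₀) +ℤ (x₀ +ℤ y) - + 4 *ℤ x₀
  rearrange = solve-∀

signedPaths : ℕ → ℕ → ℕ → ℤ
signedPaths a b k = ∑ (allSeqs (a + b)) (λ p → 𝟙 (ups p ℕP.≟ k) *ℤ sgn (ups (take a p)))

∑-allSeqs-suc : ∀ l (φ : List Step → ℤ) → ∑ (allSeqs (suc l)) φ ≡ ∑ (allSeqs l) (λ p → φ (R ∷ p) +ℤ φ (U ∷ p))
∑-allSeqs-suc l φ = trans (∑-concatMap _ φ (allSeqs l))
  (∑-cong (allSeqs l) (λ p → cong (φ (R ∷ p) +ℤ_) (ℤP.+-identityʳ (φ (U ∷ p)))))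

∑-up-shift : ∀ {A : Set} (xs : List A) (u : A → ℕ) (ψ : A → ℤ) k →
             ∑ xs (λ x → 𝟙 (suc (u x) ℕP.≟ k) *ℤ ψ x) ≡ prev (λ j → ∑ xs (λ x → 𝟙 (u x ℕP.≟ j) *ℤ ψ x)) k
∑-up-shift xs u ψ zero    = ∑-zero xs
∑-up-shift xs u ψ (suc k) = refl

signedPaths-zeroˡ : ∀ b k → signedPaths 0 b k ≡ + (b C k)
signedPaths-zeroˡ zero    zero    = refl
signedPaths-zeroˡ zero    (suc k) = refl
signedPaths-zeroˡ (suc b) k = begin
  signedPaths 0 (suc b) k
    ≡⟨ ∑-allSeqs-suc b _ ⟩
  ∑ (allSeqs b) (λ p → w p +ℤ 𝟙 (suc (ups p) ℕP.≟ k) *ℤ + 1)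
    ≡⟨ ∑-+ w _ (allSeqs b) ⟩
  signedPaths 0 b k +ℤ ∑ (allSeqs b) (λ p → 𝟙 (suc (ups p) ℕP.≟ k) *ℤ + 1)
    ≡⟨ cong₂ _+ℤ_ (signedPaths-zeroˡ b k) (∑-up-shift (allSeqs b) ups (λ _ → + 1) k) ⟩
  + (b C k) +ℤ prev (signedPaths 0 b) k
    ≡⟨ cong (+ (b C k) +ℤ_) (prev-cong (signedPaths-zeroˡ b) k) ⟩
  + (b C k) +ℤ prev (λ j → + (b C j)) k
    ≡⟨ pascal b k ⟩
  + (suc b C k) ∎
  where
  w : List Step → ℤ
  w p = 𝟙 (ups p ℕP.≟ k) *ℤ + 1

-- A first up step flips the sign of the height after a+1 steps.
signedPaths-sucˡ : ∀ a b k → signedPaths (suc a) b k ≡ signedPaths a b k - prev (signedPaths a b) k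
signedPaths-sucˡ a b k = begin
  signedPaths (suc a) b k
    ≡⟨ ∑-allSeqs-suc (a + b) _ ⟩
  ∑ (allSeqs (a + b)) (λ p → w p +ℤ 𝟙 (suc (ups p) ℕP.≟ k) *ℤ (-1ℤ *ℤ s p))
    ≡⟨ ∑-cong (allSeqs (a + b)) (λ p → flip (w p) (𝟙 (suc (ups p) ℕP.≟ k)) (s p)) ⟩
  ∑ (allSeqs (a + b)) (λ p → w p - 𝟙 (suc (ups p) ℕP.≟ k) *ℤ s p)
    ≡⟨ ∑-- w _ (allSeqs (a + b)) ⟩
  signedPaths a b k - ∑ (allSeqs (a + b)) (λ p → 𝟙 (suc (ups p) ℕP.≟ k) *ℤ s p)
    ≡⟨ cong (λ x → signedPaths a b k - x) (∑-up-shift (allSeqs (a + b)) ups s k) ⟩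
  signedPaths a b k - prev (signedPaths a b) k ∎
  where
  s w : List Step → ℤ
  s p = sgn (ups (take a p))
  w p = 𝟙 (ups p ℕP.≟ k) *ℤ s p
  flip : ∀ x i s → x +ℤ i *ℤ (-1ℤ *ℤ s) ≡ x - i *ℤ s
  flip = solve-∀

-- Both sides satisfy the same initial values and recursion in a.
signedPaths≡κ : ∀ a b k → signedPaths a b k ≡ κ a b k
signedPaths≡κ zero    b k = trans (signedPaths-zeroˡ b k) (sym (κ-zeroˡ b k))
signedPaths≡κ (suc a) b k = begin
  signedPaths (suc a) b k                        ≡⟨ signedPaths-sucˡ a b k ⟩
  signedPaths a b k - prev (signedPaths a b) k   ≡⟨ cong₂ _-_ (signedPaths≡κ a b k) (prev-cong (signedPaths≡κ a b) k) ⟩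
  κ a b k - prev (κ a b) k                       ≡⟨ κ-sucˡ a b k ⟨
  κ (suc a) b k                                  ∎

pathSum≡κ : ∀ a b N → a + b ≡ 2 * N → ∑ (paths N) (λ P → sgn (height a P)) ≡ κ a b N
pathSum≡κ a b N a+b≡2N = begin
  ∑ (paths N) (λ P → sgn (height a P))
    ≡⟨ ∑-filter (λ p → ups p ℕP.≟ N) _ (allSeqs (2 * N)) ⟩
  ∑ (allSeqs (2 * N)) (λ p → 𝟙 (ups p ℕP.≟ N) *ℤ sgn (ups (take a p)))
    ≡⟨ cong (λ l → ∑ (allSeqs l) (λ p → 𝟙 (ups p ℕP.≟ N) *ℤ sgn (ups (take a p)))) a+b≡2N ⟨
  signedPaths a b N
    ≡⟨ signedPaths≡κ a b N ⟩
  κ a b N ∎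

numer denom : ℕ → ℕ → ℕ
numer m n = (2 * m) ! * (2 * n) !
denom m n = m ! * n ! * (m + n) !

denom≢0 : ∀ m n → NonZero (denom m n)
denom≢0 m n = ℕP.m*n≢0 (m ! * n !) ((m + n) !) {{ℕP._!*_!≢0 m n}} {{ℕP._!≢0 (m + n)}}

binomial-factorials : ∀ {n k} → k ≤ n → (n C k) * (k ! * (n ∸ k) !) ≡ n !
binomial-factorials {n} {k} k≤n =
  trans (cong (_* (k ! * (n ∸ k) !)) (nCk≡n!/k![n-k]! k≤n)) (m/n*n≡m (k![n∸k]!∣n! k≤n))
  where instance _ = ℕP._!*_!≢0 k (n ∸ k)

central-binomial : ∀ n → ((2 * n) C n) * denom 0 n ≡ numer 0 n
central-binomial n = begin
  ((2 * n) C n) * (1 * n ! * n !)         ≡⟨ cong (λ x → ((2 * n) C n) * (x * n !)) (ℕP.*-identityˡ (n !)) ⟩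
  ((2 * n) C n) * (n ! * n !)             ≡⟨ cong (λ j → ((2 * n) C n) * (n ! * j !)) 2n∸n≡n ⟨
  ((2 * n) C n) * (n ! * (2 * n ∸ n) !)   ≡⟨ binomial-factorials (ℕP.m≤m+n n (n + 0)) ⟩
  (2 * n) !                               ≡⟨ ℕP.*-identityˡ ((2 * n) !) ⟨
  1 * (2 * n) !                           ∎
  where
  2n∸n≡n : 2 * n ∸ n ≡ n
  2n∸n≡n = trans (ℕP.m+n∸m≡n n (n + 0)) (ℕP.+-identityʳ n)

denom-sucˡ : ∀ m n → denom (suc m) n ≡ suc m * suc (m + n) * denom m n
denom-sucˡ m n = regroup (suc m) (suc (m + n)) (m !) (n !) ((m + n) !)
  where
  regroup : ∀ x y a b c → (x * a) * b * (y * c) ≡ x * y * (a * b * c)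
  regroup = ℕSolver.solve-∀

denom-sucʳ : ∀ m n → denom m (suc n) ≡ suc n * suc (m + n) * denom m n
denom-sucʳ m n = begin
  m ! * (suc n) ! * (m + suc n) !   ≡⟨ cong (λ j → m ! * (suc n) ! * j !) (ℕP.+-suc m n) ⟩
  m ! * (suc n) ! * (suc (m + n)) ! ≡⟨ regroup (suc n) (suc (m + n)) (m !) (n !) ((m + n) !) ⟩
  suc n * suc (m + n) * denom m n  ∎
  where
  regroup : ∀ x y a b c → a * (x * b) * (y * c) ≡ x * y * (a * b * c)
  regroup = ℕSolver.solve-∀

double-factorial-suc : ∀ m → (2 * suc m) ! ≡ (2 + 2 * m) * (1 + 2 * m) * (2 * m) !
double-factorial-suc m = trans (cong _! (ℕP.*-suc 2 m)) (sym (ℕP.*-assoc (2 + 2 * m) (1 + 2 * m) ((2 * m) !)))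

numer-sucˡ : ∀ m n → numer (suc m) n ≡ (2 + 2 * m) * (1 + 2 * m) * numer m n
numer-sucˡ m n = trans (cong (_* (2 * n) !) (double-factorial-suc m))
                       (ℕP.*-assoc ((2 + 2 * m) * (1 + 2 * m)) ((2 * m) !) ((2 * n) !))

numer-sucʳ : ∀ m n → numer m (suc n) ≡ (2 + 2 * n) * (1 + 2 * n) * numer m n
numer-sucʳ m n = trans (cong ((2 * m) ! *_) (double-factorial-suc n))
                       (regroup (2 + 2 * n) (1 + 2 * n) ((2 * m) !) ((2 * n) !))
  where
  regroup : ∀ x y a b → a * (x * y * b) ≡ x * y * (a * b)
  regroup = ℕSolver.solve-∀

pos-*³ : ∀ x y z → + (x * y * z) ≡ + x *ℤ + y *ℤ + z
pos-*³ x y z = trans (ℤP.pos-* (x * y) z) (cong (_*ℤ + z) (ℤP.pos-* x y))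

pos-double : ∀ k m → + (k + 2 * m) ≡ + k +ℤ + 2 *ℤ + m
pos-double k m = cong (+ k +ℤ_) (ℤP.pos-* 2 m)

-- The recursion step of the super Catalan numbers, cleared of denominators:
-- if f = p/d and f' = p (2n+2)(2n+1) / (d (n+1)(m+n+1)) then
-- 4f - f' = p (2m+2)(2m+1) / (d (m+1)(m+n+1)), after multiplying by n+1.
superCatalan-step : ∀ (M N d p f f′ : ℤ) → f *ℤ d ≡ p →
  f′ *ℤ ((+ 1 +ℤ N) *ℤ (+ 1 +ℤ (M +ℤ N)) *ℤ d) ≡ (+ 2 +ℤ + 2 *ℤ N) *ℤ (+ 1 +ℤ + 2 *ℤ N) *ℤ p →
  (+ 4 *ℤ f - f′) *ℤ ((+ 1 +ℤ M) *ℤ (+ 1 +ℤ (M +ℤ N)) *ℤ d) *ℤ (+ 1 +ℤ N)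
    ≡ (+ 2 +ℤ + 2 *ℤ M) *ℤ (+ 1 +ℤ + 2 *ℤ M) *ℤ p *ℤ (+ 1 +ℤ N)
superCatalan-step M N d p f f′ e e′ = begin
  (+ 4 *ℤ f - f′) *ℤ ((+ 1 +ℤ M) *ℤ (+ 1 +ℤ (M +ℤ N)) *ℤ d) *ℤ (+ 1 +ℤ N)
    ≡⟨ expand M N d f f′ ⟩
  + 4 *ℤ (+ 1 +ℤ M) *ℤ (+ 1 +ℤ (M +ℤ N)) *ℤ (+ 1 +ℤ N) *ℤ (f *ℤ d)
    - (+ 1 +ℤ M) *ℤ (f′ *ℤ ((+ 1 +ℤ N) *ℤ (+ 1 +ℤ (M +ℤ N)) *ℤ d))
    ≡⟨ cong₂ (λ x y → + 4 *ℤ (+ 1 +ℤ M) *ℤ (+ 1 +ℤ (M +ℤ N)) *ℤ (+ 1 +ℤ N) *ℤ x - (+ 1 +ℤ M) *ℤ y) e e′ ⟩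
  + 4 *ℤ (+ 1 +ℤ M) *ℤ (+ 1 +ℤ (M +ℤ N)) *ℤ (+ 1 +ℤ N) *ℤ p
    - (+ 1 +ℤ M) *ℤ ((+ 2 +ℤ + 2 *ℤ N) *ℤ (+ 1 +ℤ + 2 *ℤ N) *ℤ p)
    ≡⟨ collect M N p ⟩
  (+ 2 +ℤ + 2 *ℤ M) *ℤ (+ 1 +ℤ + 2 *ℤ M) *ℤ p *ℤ (+ 1 +ℤ N) ∎
  where
  expand : ∀ M N d f f′ →
    (+ 4 *ℤ f - f′) *ℤ ((+ 1 +ℤ M) *ℤ (+ 1 +ℤ (M +ℤ N)) *ℤ d) *ℤ (+ 1 +ℤ N)
      ≡ + 4 *ℤ (+ 1 +ℤ M) *ℤ (+ 1 +ℤ (M +ℤ N)) *ℤ (+ 1 +ℤ N) *ℤ (f *ℤ d)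
        - (+ 1 +ℤ M) *ℤ (f′ *ℤ ((+ 1 +ℤ N) *ℤ (+ 1 +ℤ (M +ℤ N)) *ℤ d))
  expand = solve-∀
  collect : ∀ M N p →
    + 4 *ℤ (+ 1 +ℤ M) *ℤ (+ 1 +ℤ (M +ℤ N)) *ℤ (+ 1 +ℤ N) *ℤ p
      - (+ 1 +ℤ M) *ℤ ((+ 2 +ℤ + 2 *ℤ N) *ℤ (+ 1 +ℤ + 2 *ℤ N) *ℤ p)
      ≡ (+ 2 +ℤ + 2 *ℤ M) *ℤ (+ 1 +ℤ + 2 *ℤ M) *ℤ p *ℤ (+ 1 +ℤ N)
  collect = solve-∀

module SuperCatalanCharacterisation
  (F : ℕ → ℕ → ℤ)
  (F-zeroˡ : ∀ n → F 0 n ≡ + ((2 * n) C n))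
  (F-sucˡ : ∀ m n → F (suc m) n ≡ + 4 *ℤ F m n - F m (suc n)) where

  cleared : ∀ m n → F m n *ℤ + denom m n ≡ + numer m n
  cleared zero n = begin
    F 0 n *ℤ + denom 0 n             ≡⟨ cong (_*ℤ + denom 0 n) (F-zeroˡ n) ⟩
    + ((2 * n) C n) *ℤ + denom 0 n   ≡⟨ ℤP.pos-* ((2 * n) C n) (denom 0 n) ⟨
    + (((2 * n) C n) * denom 0 n)    ≡⟨ cong +_ (central-binomial n) ⟩
    + numer 0 n                      ∎
  cleared (suc m) n = ℤP.*-cancelʳ-≡ _ _ (+ suc n) (begin
    F (suc m) n *ℤ + denom (suc m) n *ℤ + suc n
      ≡⟨ cong₂ (λ f d → f *ℤ d *ℤ + suc n) (F-sucˡ m n)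
               (trans (cong +_ (denom-sucˡ m n)) (pos-*³ (suc m) (suc (m + n)) (denom m n))) ⟩
    (+ 4 *ℤ F m n - F m (suc n)) *ℤ (+ suc m *ℤ + suc (m + n) *ℤ + denom m n) *ℤ + suc n
      ≡⟨ superCatalan-step (+ m) (+ n) (+ denom m n) (+ numer m n) (F m n) (F m (suc n))
                           (cleared m n) shifted ⟩
    (+ 2 +ℤ + 2 *ℤ + m) *ℤ (+ 1 +ℤ + 2 *ℤ + m) *ℤ + numer m n *ℤ + suc n
      ≡⟨ cong (_*ℤ + suc n) (numer-ratio m (numer m n) (numer-sucˡ m n)) ⟨
    + numer (suc m) n *ℤ + suc n ∎)
    where
    numer-ratio : ∀ {x} k p → x ≡ (2 + 2 * k) * (1 + 2 * k) * p →
                  + x ≡ (+ 2 +ℤ + 2 *ℤ + k) *ℤ (+ 1 +ℤ + 2 *ℤ + k) *ℤ + p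
    numer-ratio k p e = trans (cong +_ e) (trans (pos-*³ (2 + 2 * k) (1 + 2 * k) p)
      (cong₂ (λ y z → y *ℤ z *ℤ + p) (pos-double 2 k) (pos-double 1 k)))
    shifted : F m (suc n) *ℤ (+ suc n *ℤ + suc (m + n) *ℤ + denom m n)
                ≡ (+ 2 +ℤ + 2 *ℤ + n) *ℤ (+ 1 +ℤ + 2 *ℤ + n) *ℤ + numer m n
    shifted = begin
      F m (suc n) *ℤ (+ suc n *ℤ + suc (m + n) *ℤ + denom m n)
        ≡⟨ cong (F m (suc n) *ℤ_) (trans (cong +_ (denom-sucʳ m n)) (pos-*³ (suc n) (suc (m + n)) (denom m n))) ⟨
      F m (suc n) *ℤ + denom m (suc n)
        ≡⟨ cleared m (suc n) ⟩
      + numer m (suc n)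
        ≡⟨ numer-ratio n (numer m n) (numer-sucʳ m n) ⟩
      (+ 2 +ℤ + 2 *ℤ + n) *ℤ (+ 1 +ℤ + 2 *ℤ + n) *ℤ + numer m n ∎

exact-quotient : ∀ (x : ℤ) p d .{{_ : NonZero d}} → x *ℤ + d ≡ + p → + (p / d) ≡ x
exact-quotient (+ q)     p d e = cong +_ (trans (cong (_/ d) (sym q*d≡p)) (m*n/n≡m q d))
  where
  q*d≡p : q * d ≡ p
  q*d≡p = ℤP.+-injective (trans (ℤP.pos-* q d) e)
exact-quotient -[1+ q ] p zero    e = ⊥-elim (≢-nonZero⁻¹ 0 refl)
exact-quotient -[1+ q ] p (suc d) ()

sgn-involutive : ∀ m x → sgn m *ℤ (sgn m *ℤ x) ≡ x
sgn-involutive zero    x = trans (ℤP.*-identityˡ _) (ℤP.*-identityˡ x)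
sgn-involutive (suc m) x = trans (flip (sgn m) x) (sgn-involutive m x)
  where
  flip : ∀ s x → (-1ℤ *ℤ s) *ℤ ((-1ℤ *ℤ s) *ℤ x) ≡ s *ℤ (s *ℤ x)
  flip = solve-∀

signedκ : ℕ → ℕ → ℤ
signedκ m n = sgn m *ℤ κ (2 * m) (2 * n) (m + n)

signedκ-zeroˡ : ∀ n → signedκ 0 n ≡ + ((2 * n) C n)
signedκ-zeroˡ n = trans (ℤP.*-identityˡ _) (κ-zeroˡ (2 * n) n)

signedκ-sucˡ : ∀ m n → signedκ (suc m) n ≡ + 4 *ℤ signedκ m n - signedκ m (suc n)
signedκ-sucˡ m n = begin
  (-1ℤ *ℤ sgn m) *ℤ κ (2 * suc m) (2 * n) (suc (m + n))
    ≡⟨ cong (λ a → (-1ℤ *ℤ sgn m) *ℤ κ a (2 * n) (suc (m + n))) (ℕP.*-suc 2 m) ⟩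
  (-1ℤ *ℤ sgn m) *ℤ κ (2 + 2 * m) (2 * n) (suc (m + n))
    ≡⟨ cong ((-1ℤ *ℤ sgn m) *ℤ_) (κ-step (2 * m) (2 * n) (m + n)) ⟩
  (-1ℤ *ℤ sgn m) *ℤ (κ (2 * m) (2 + 2 * n) (suc (m + n)) - + 4 *ℤ κ (2 * m) (2 * n) (m + n))
    ≡⟨ flip (sgn m) _ _ ⟩
  + 4 *ℤ signedκ m n - sgn m *ℤ κ (2 * m) (2 + 2 * n) (suc (m + n))
    ≡⟨ cong (λ x → + 4 *ℤ signedκ m n - sgn m *ℤ x)
            (cong₂ (κ (2 * m)) (ℕP.*-suc 2 n) (ℕP.+-suc m n)) ⟨
  + 4 *ℤ signedκ m n - signedκ m (suc n) ∎
  where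
  flip : ∀ s x y → (-1ℤ *ℤ s) *ℤ (x - + 4 *ℤ y) ≡ + 4 *ℤ (s *ℤ y) - s *ℤ x
  flip = solve-∀

S≡signedκ : ∀ m n → + S m n ≡ signedκ m n
S≡signedκ m n = exact-quotient (signedκ m n) (numer m n) (denom m n) {{denom≢0 m n}}
  (SuperCatalanCharacterisation.cleared signedκ signedκ-zeroˡ signedκ-sucˡ m n)

mainTheorem1 : (m n : ℕ) →
    (+ S m n ≡ sgn m *ℤ sumℤ (map (λ P → sgn (height (2 * m) P)) (paths (m + n))))
    × (K (m + n) (2 * (m + n)) (2 * m) ≡ sgn m *ℤ + S m n)
mainTheorem1 m n = pathIdentity , krawtchoukIdentity
  where
  2m+2n≡2[m+n] : 2 * m + 2 * n ≡ 2 * (m + n)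
  2m+2n≡2[m+n] = sym (ℕP.*-distribˡ-+ 2 m n)

  pathIdentity : + S m n ≡ sgn m *ℤ ∑ (paths (m + n)) (λ P → sgn (height (2 * m) P))
  pathIdentity = trans (S≡signedκ m n)
    (cong (sgn m *ℤ_) (sym (pathSum≡κ (2 * m) (2 * n) (m + n) 2m+2n≡2[m+n])))

  krawtchoukIdentity : K (m + n) (2 * (m + n)) (2 * m) ≡ sgn m *ℤ + S m n
  krawtchoukIdentity = begin
    κ (2 * m) (2 * (m + n) ∸ 2 * m) (m + n)
      ≡⟨ cong (λ b → κ (2 * m) b (m + n))
              (trans (cong (_∸ 2 * m) (sym 2m+2n≡2[m+n])) (ℕP.m+n∸m≡n (2 * m) (2 * n))) ⟩
    κ (2 * m) (2 * n) (m + n)      ≡⟨ sgn-involutive m _ ⟨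
    sgn m *ℤ signedκ m n           ≡⟨ cong (sgn m *ℤ_) (S≡signedκ m n) ⟨
    sgn m *ℤ + S m n               ∎
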